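{- For every integer $n\ge 2$, $\chi_{la}(C_{2n}[O_2])=3$.
   Context: For a graph $G=(V,E)$ with $q$ edges, a bijection $f:E\to\{1,\ldots,q\}$ is a local antimagic labeling if $f^+(u)\ne f^+(v)$ for all adjacent $u,v$, where $f^+(u)$ is the sum of labels of edges incident to $u$. $\chi_{la}(G)$ is the minimum number of distinct values of $f^+$ over all local antimagic labelings of $G$. $O_2$ is the edgeless graph on $2$ vertices; $G[H]$ is the lexicographic product: vertex set $V(G)\times V(H)$, with $(u,u')\sim(v,v')$ iff $uv\in E(G)$, or $u=v$ and $u'v'\in E(H)$. -}

module Defs where

open import Data.Nat as ℕ using (ℕ; zero; suc; _+_; _*_; _≤_)
import Data.Nat.Properties as ℕP
open import Data.Fin as Fin using (Fin; toℕ; remQuot)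
import Data.Fin.Properties as FinP
open import Data.List using (List; []; _∷_; map; concatMap; filter; length; lookup; allFin; deduplicate)
open import Data.Nat.ListAction using (sum)
open import Data.Product using (_×_; _,_; proj₁; proj₂; Σ; ∃)
open import Data.Sum using (_⊎_)
open import Data.Bool using (Bool; if_then_else_; _∨_)
open import Data.Empty using (⊥)
open import Relation.Nullary using (¬_; Dec; yes; no; does)
open import Relation.Nullary.Decidable using (_⊎-dec_; _×-dec_)
open import Relation.Binary.PropositionalEquality using (_≡_; _≢_)
open import Function.Definitions using (Bijective)

-- A finite simple graph on vertex set Fin nv, given by a decidable
-- adjacency relation (assumed symmetric by the constructions below).
record Graph : Set₁ where
  field
    nv   : ℕ
    Adj  : Fin nv → Fin nv → Set
    adj? : (u v : Fin nv) → Dec (Adj u v)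
open Graph public

edges : (G : Graph) → List (Fin (nv G) × Fin (nv G))
edges G = filter (λ p → (proj₁ p Fin.<? proj₂ p) ×-dec adj? G (proj₁ p) (proj₂ p))
                 (concatMap (λ u → map (u ,_) (allFin (nv G))) (allFin (nv G)))

nE : Graph → ℕ
nE G = length (edges G)

edge : (G : Graph) → Fin (nE G) → Fin (nv G) × Fin (nv G)
edge G = lookup (edges G)

-- an edge labeling: a bijection from E to {1,…,q}, encoded as a
-- bijection f : Fin q → Fin q, edge k receiving label 1 + toℕ (f k)
record Labeling (G : Graph) : Set where
  field
    f   : Fin (nE G) → Fin (nE G)
    bij : Bijective _≡_ _≡_ f
open Labeling public

label : {G : Graph} → Labeling G → Fin (nE G) → ℕ
label L k = suc (toℕ (f L k))

incident : (G : Graph) → Fin (nv G) → Fin (nE G) → Bool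
incident G u k = does (proj₁ (edge G k) Fin.≟ u) ∨ does (proj₂ (edge G k) Fin.≟ u)

vsum : {G : Graph} → Labeling G → Fin (nv G) → ℕ
vsum {G} L u = sum (map (λ k → if incident G u k then label L k else 0) (allFin (nE G)))

IsLocalAntimagic : {G : Graph} → Labeling G → Set
IsLocalAntimagic {G} L = ∀ u v → Adj G u v → vsum L u ≢ vsum L v

numColors : {G : Graph} → Labeling G → ℕ
numColors {G} L = length (deduplicate ℕ._≟_ (map (vsum L) (allFin (nv G))))

ChiLa≡ : Graph → ℕ → Set
ChiLa≡ G c =
  (Σ (Labeling G) λ L → IsLocalAntimagic L × numColors L ≡ c)
  × (∀ (L : Labeling G) → IsLocalAntimagic L → c ≤ numColors L)

CycStep : (m : ℕ) → Fin m → Fin m → Set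
CycStep m i j = (suc (toℕ i) ≡ toℕ j) ⊎ ((toℕ i ≡ 0) × (suc (toℕ j) ≡ m))

cycStep? : (m : ℕ) → (i j : Fin m) → Dec (CycStep m i j)
cycStep? m i j = (suc (toℕ i) ℕ.≟ toℕ j) ⊎-dec ((toℕ i ℕ.≟ 0) ×-dec (suc (toℕ j) ℕ.≟ m))

Cycle : ℕ → Graph
Cycle m = record
  { nv = m
  ; Adj = λ i j → CycStep m i j ⊎ CycStep m j i
  ; adj? = λ i j → cycStep? m i j ⊎-dec cycStep? m j i }

Empty : ℕ → Graph
Empty k = record { nv = k ; Adj = λ _ _ → ⊥ ; adj? = λ _ _ → no (λ ()) }

-- lexicographic product G[H]; V(G) × V(H) encoded as Fin (nv G * nv H)
-- via Data.Fin.remQuot / combine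
Lex : Graph → Graph → Graph
Lex G H = record
  { nv = nv G * nv H
  ; Adj = λ x y → LAdj (remQuot (nv H) x) (remQuot (nv H) y)
  ; adj? = λ x y → LAdj? (remQuot (nv H) x) (remQuot (nv H) y) }
  where
  LAdj : Fin (nv G) × Fin (nv H) → Fin (nv G) × Fin (nv H) → Set
  LAdj (u , u') (v , v') = Adj G u v ⊎ ((u ≡ v) × Adj H u' v')
  LAdj? : ∀ a b → Dec (LAdj a b)
  LAdj? (u , u') (v , v') = adj? G u v ⊎-dec ((u Fin.≟ v) ×-dec adj? H u' v')

module Submission where

-- Write m = 2n and view vertex x of C_m[O_2] as copy x mod 2 of the cycle vertex
-- (layer) ⌊x/2⌋.
--
-- If a local antimagic labeling had at most two vertex sums A ≠ B,
-- they would properly 2-colour this connected bipartite graph, so (walking round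
-- the cycle) every vertex of an even layer gets A and every vertex of an odd layer
-- gets B.  Each edge joins an even and an odd layer, so summing f⁺ over either
-- side counts every label once: 2n·A = 2n·B, a contradiction.
--
-- With q = 4m edges, give the edge from copy s of layer p to copy t
-- of its successor p′ the label 4p + 1 + 2s + t when p is even, and
-- q − 4p′ − 2t − s when p is odd; even layers use the label blocks of even index,
-- odd layers the reflected blocks of odd index, so this is a bijection onto
-- {1, …, q}.  The reflection makes the copy index cancel in every vertex sum, which
-- is 2(q + 1) on even layers, 2(q − 7) on odd layers and 2(q + 4(m − 2) + 1) on
-- the last layer m − 1.

open import Defs
open import Data.Nat as ℕ using (ℕ; zero; suc; _+_; _*_; _∸_; _≤_; _<_; z≤n; s≤s; z<s; s<s; _≡ᵇ_; _<ᵇ_; ⌊_/2⌋)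
open import Data.Nat.Properties
open import Data.Nat.DivMod using (_/_; _%_; m≡m%n+[m/n]*n; m%n<n; m<n*o⇒m/o<n)
open import Data.Nat.ListAction using (sum)
open import Data.Nat.ListAction.Properties using (sum-++)
open import Algebra.Properties.CommutativeSemigroup +-commutativeSemigroup using (interchange)
open import Data.Fin as Fin using (Fin; toℕ; fromℕ<; remQuot)
import Data.Fin.Properties as FinP
open import Data.List using (List; []; _∷_; _++_; map; concatMap; filter; length; lookup; allFin; tabulate; deduplicate)
import Data.List.Properties as LP
open import Data.List.Membership.Propositional using (_∈_; lose)
open import Data.List.Membership.Propositional.Properties using (∈-lookup; ∈-filter⁻; ∈-filter⁺; ∈-concatMap⁺; ∈-map⁺; ∈-map⁻; ∈-allFin; ∈-deduplicate⁺; ∈-deduplicate⁻; ∈-∃++)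
open import Data.List.Relation.Unary.Any using (here; there; index)
open import Data.List.Relation.Unary.Any.Properties using (lookup-index)
import Data.List.Relation.Unary.All as All
open import Data.List.Relation.Unary.AllPairs using ([]; _∷_)
open import Data.List.Relation.Unary.Unique.Propositional using (Unique)
open import Data.List.Relation.Unary.Unique.DecPropositional.Properties using (deduplicate-!)
open import Data.Product using (_×_; _,_; proj₁; proj₂; ∃; ∃₂)
open import Data.Sum using (_⊎_; inj₁; inj₂)
open import Data.Bool using (Bool; true; false; if_then_else_; _∨_; _∧_; not; T)
open import Data.Bool.Properties using (∧-zeroʳ; ∧-identityʳ; ∨-identityʳ; ∨-comm; not-involutive; not-injective)
open import Data.Unit using (tt)
open import Data.Empty using (⊥)
open import Relation.Nullary using (Dec; yes; no; does; contradiction; _×-dec_)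
open import Relation.Nullary.Decidable using (dec-true)
open import Relation.Binary.Definitions using (Tri; tri<; tri≈; tri>)
open import Relation.Binary.PropositionalEquality
open import Function using (_∘_; id)

≡ᵇ-refl : ∀ n → (n ≡ᵇ n) ≡ true
≡ᵇ-refl zero    = refl
≡ᵇ-refl (suc n) = ≡ᵇ-refl n

≡ᵇ-sym : ∀ m n → (m ≡ᵇ n) ≡ (n ≡ᵇ m)
≡ᵇ-sym zero    zero    = refl
≡ᵇ-sym zero    (suc n) = refl
≡ᵇ-sym (suc m) zero    = refl
≡ᵇ-sym (suc m) (suc n) = ≡ᵇ-sym m n

≡ᵇ-true⇒≡ : ∀ m n → (m ≡ᵇ n) ≡ true → m ≡ n
≡ᵇ-true⇒≡ m n e = ≡ᵇ⇒≡ m n (subst T (sym e) tt)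

≡ᵇ-false⇒≢ : ∀ m n → (m ≡ᵇ n) ≡ false → m ≢ n
≡ᵇ-false⇒≢ m .m e refl = contradiction (trans (sym (≡ᵇ-refl m)) e) λ ()

≢⇒≡ᵇ-false : ∀ m n → m ≢ n → (m ≡ᵇ n) ≡ false
≢⇒≡ᵇ-false m n m≢n with m ≡ᵇ n in e
... | true  = contradiction (≡ᵇ-true⇒≡ m n e) m≢n
... | false = refl

<ᵇ-irrefl : ∀ n → (n <ᵇ n) ≡ false
<ᵇ-irrefl zero    = refl
<ᵇ-irrefl (suc n) = <ᵇ-irrefl n

<ᵇ-asym : ∀ m n → (m <ᵇ n) ≡ true → (n <ᵇ m) ≡ false
<ᵇ-asym zero    (suc n) _ = refl
<ᵇ-asym (suc m) (suc n) e = <ᵇ-asym m n e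

<ᵇ-trichotomy : ∀ m n → (m ≡ᵇ n) ≡ false → (m <ᵇ n) ≡ false → (n <ᵇ m) ≡ true
<ᵇ-trichotomy zero    (suc n) _ ()
<ᵇ-trichotomy (suc m) zero    _ _ = refl
<ᵇ-trichotomy (suc m) (suc n) e l = <ᵇ-trichotomy m n e l

[n∸c]+[1+w+c]≡n+[1+w] : ∀ n c w → c ≤ n → (n ∸ c) + suc (w + c) ≡ n + suc w
[n∸c]+[1+w+c]≡n+[1+w] n c w c≤n = begin
  (n ∸ c) + suc (w + c) ≡⟨ +-suc (n ∸ c) (w + c) ⟩
  suc (n ∸ c + (w + c)) ≡⟨ cong (λ z → suc (n ∸ c + z)) (+-comm w c) ⟩
  suc (n ∸ c + (c + w)) ≡⟨ cong suc (+-assoc (n ∸ c) c w) ⟨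
  suc (n ∸ c + c + w)   ≡⟨ cong (λ z → suc (z + w)) (m∸n+n≡m c≤n) ⟩
  suc (n + w)           ≡⟨ +-suc n w ⟨
  n + suc w             ∎
  where open ≡-Reasoning

[n∸[8+y]]+[1+y]≡n∸7 : ∀ n y → 8 + y ≤ n → (n ∸ (8 + y)) + suc y ≡ n ∸ 7
[n∸[8+y]]+[1+y]≡n∸7 n y 8+y≤n = sym (begin
  n ∸ 7                        ≡⟨ cong (_∸ 7) (m∸n+n≡m 8+y≤n) ⟨
  (n ∸ (8 + y)) + (8 + y) ∸ 7  ≡⟨ +-∸-assoc (n ∸ (8 + y)) {8 + y} {7} (s≤s (s≤s (s≤s (s≤s (s≤s (s≤s (s≤s z≤n))))))) ⟩
  (n ∸ (8 + y)) + suc y        ∎)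
  where open ≡-Reasoning

suc[n∸1]≡n : ∀ {n} → 1 ≤ n → suc (n ∸ 1) ≡ n
suc[n∸1]≡n {suc n} _ = refl

even⊎odd : ∀ n → ∃ λ g → n ≡ g * 2 ⊎ n ≡ suc (g * 2)
even⊎odd zero          = 0 , inj₁ refl
even⊎odd (suc zero)    = 0 , inj₂ refl
even⊎odd (suc (suc n)) with even⊎odd n
... | g , inj₁ refl = suc g , inj₁ refl
... | g , inj₂ refl = suc g , inj₂ refl

m+m≡n+n⇒m≡n : ∀ m n → m + m ≡ n + n → m ≡ n
m+m≡n+n⇒m≡n m n eq = *-cancelˡ-≡ m n 2 (begin
  2 * m  ≡⟨ cong (m +_) (+-identityʳ m) ⟩
  m + m  ≡⟨ eq ⟩
  n + n  ≡⟨ cong (n +_) (+-identityʳ n) ⟨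
  2 * n  ∎)
  where open ≡-Reasoning

≡not⇒≡not : ∀ {a b} → a ≡ not b → b ≡ not a
≡not⇒≡not {true}  {false} refl = refl
≡not⇒≡not {false} {true}  refl = refl

⊆-pair : (xs : List ℕ) → length xs ≤ 2 → ∃₂ λ a b → ∀ z → z ∈ xs → z ≡ a ⊎ z ≡ b
⊆-pair []              _                 = 0 , 0 , λ _ ()
⊆-pair (a ∷ [])        _                 = a , a , λ { z (here z≡a) → inj₁ z≡a }
⊆-pair (a ∷ b ∷ [])    _                 = a , b , λ { z (here z≡a) → inj₁ z≡a ; z (there (here z≡b)) → inj₂ z≡b }
⊆-pair (a ∷ b ∷ c ∷ _) (s≤s (s≤s ()))

pair-switch : ∀ {a b x y z : ℕ} → x ≡ a ⊎ x ≡ b → y ≡ a ⊎ y ≡ b → x ≢ y → z ≡ a ⊎ z ≡ b → z ≡ x ⊎ z ≡ y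
pair-switch (inj₁ refl) (inj₁ refl) x≢y _           = contradiction refl x≢y
pair-switch (inj₁ refl) (inj₂ refl) _   (inj₁ refl) = inj₁ refl
pair-switch (inj₁ refl) (inj₂ refl) _   (inj₂ refl) = inj₂ refl
pair-switch (inj₂ refl) (inj₁ refl) _   (inj₁ refl) = inj₂ refl
pair-switch (inj₂ refl) (inj₁ refl) _   (inj₂ refl) = inj₁ refl
pair-switch (inj₂ refl) (inj₂ refl) x≢y _           = contradiction refl x≢y

Unique⇒length≤ : ∀ {xs ys : List ℕ} → Unique xs → (∀ {z} → z ∈ xs → z ∈ ys) → length xs ≤ length ys
Unique⇒length≤ {[]}     _              _    = z≤n
Unique⇒length≤ {x ∷ xs} (x∉xs ∷ unique) xs⊆ys with us , vs , refl ← ∈-∃++ (xs⊆ys (here refl)) = begin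
  suc (length xs)          ≤⟨ s≤s (Unique⇒length≤ unique (λ z∈xs → drop us (xs⊆ys (there z∈xs)) (All.lookup x∉xs z∈xs))) ⟩
  suc (length (us ++ vs))  ≡⟨ cong suc (LP.length-++ us) ⟩
  suc (length us + length vs) ≡⟨ +-suc (length us) (length vs) ⟨
  length us + length (x ∷ vs) ≡⟨ LP.length-++ us ⟨
  length (us ++ x ∷ vs)    ∎
  where
  open ≤-Reasoning
  drop : ∀ (us : List ℕ) {vs z} → z ∈ us ++ x ∷ vs → x ≢ z → z ∈ us ++ vs
  drop []       (here refl) x≢z = contradiction refl x≢z
  drop []       (there z∈)  _   = z∈
  drop (u ∷ us) (here z≡u)  _   = here z≡u
  drop (u ∷ us) (there z∈)  x≢z = there (drop us z∈ x≢z)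

injective⇒surjective : ∀ {n} (f : Fin n → Fin n) → (∀ {x y} → f x ≡ f y → x ≡ y) → ∀ y → ∃ λ x → f x ≡ y
injective⇒surjective {suc n} f f-inj y with FinP.any? (λ x → f x FinP.≟ y)
... | yes hit = hit
... | no miss = contradiction (FinP.injective⇒≤ f′-inj) 1+n≰n
  where
  f′ : Fin (suc n) → Fin n
  f′ x = Fin.punchOut {i = y} {j = f x} (λ y≡fx → miss (x , sym y≡fx))
  f′-inj : ∀ {x x′} → f′ x ≡ f′ x′ → x ≡ x′
  f′-inj {x} {x′} eq = f-inj (FinP.punchOut-injective (λ y≡fx → miss (x , sym y≡fx)) (λ y≡fx′ → miss (x′ , sym y≡fx′)) eq)

surjective⇒injective : ∀ {n} (f : Fin n → Fin n) → (∀ y → ∃ λ x → f x ≡ y) → ∀ {x y} → f x ≡ f y → x ≡ y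
surjective⇒injective {n} f f-surj {x} {y} fx≡fy = begin
  x                    ≡⟨ proj₂ (g-surj x) ⟨
  g (proj₁ (g-surj x)) ≡⟨ cong g (begin
    proj₁ (g-surj x)          ≡⟨ f∘g _ ⟨
    f (g (proj₁ (g-surj x)))  ≡⟨ cong f (proj₂ (g-surj x)) ⟩
    f x                       ≡⟨ fx≡fy ⟩
    f y                       ≡⟨ cong f (proj₂ (g-surj y)) ⟨
    f (g (proj₁ (g-surj y)))  ≡⟨ f∘g _ ⟩
    proj₁ (g-surj y)          ∎) ⟩
  g (proj₁ (g-surj y)) ≡⟨ proj₂ (g-surj y) ⟩
  y                    ∎
  where
  open ≡-Reasoning
  g : Fin n → Fin n
  g y = proj₁ (f-surj y)
  f∘g : ∀ y → f (g y) ≡ y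
  f∘g y = proj₂ (f-surj y)
  g-surj : ∀ x → ∃ λ y → g y ≡ x
  g-surj = injective⇒surjective g (λ {y} {y′} eq → trans (sym (f∘g y)) (trans (cong f eq) (f∘g y′)))

when : Bool → ℕ → ℕ
when b x = if b then x else 0

when-distrib-+ : ∀ b x y → when b x + when b y ≡ when b (x + y)
when-distrib-+ true  x y = refl
when-distrib-+ false x y = refl

when-comm : ∀ b c x → when b (when c x) ≡ when c (when b x)
when-comm true  true  x = refl
when-comm true  false x = refl
when-comm false true  x = refl
when-comm false false x = refl

when-not : ∀ b x → when b x + when (not b) x ≡ x
when-not true  x = +-identityʳ x
when-not false x = refl

when-≡ᵇ-∨ : ∀ a b y x → a ≢ b → when ((a ≡ᵇ y) ∨ (b ≡ᵇ y)) x ≡ when (a ≡ᵇ y) x + when (b ≡ᵇ y) x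
when-≡ᵇ-∨ a b y x a≢b with a ≡ᵇ y in ea | b ≡ᵇ y in eb
... | true  | true  = contradiction (trans (≡ᵇ-true⇒≡ a y ea) (sym (≡ᵇ-true⇒≡ b y eb))) a≢b
... | true  | false = sym (+-identityʳ x)
... | false | true  = refl
... | false | false = refl

-- Sums over Fin n are moved to [0, n) ⊆ ℕ (see sum-allFin), where the layer and
-- copy arithmetic of C_m[O_2] is done.
∑< : ℕ → (ℕ → ℕ) → ℕ
∑< zero    f = 0
∑< (suc n) f = f 0 + ∑< n (f ∘ suc)

syntax ∑< n (λ y → e) = ∑[ y < n ] e

∑<-cong : ∀ n {f g : ℕ → ℕ} → (∀ y → y < n → f y ≡ g y) → ∑< n f ≡ ∑< n g
∑<-cong zero    f≗g = refl
∑<-cong (suc n) f≗g = cong₂ _+_ (f≗g 0 z<s) (∑<-cong n (λ y y<n → f≗g (suc y) (s<s y<n)))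

∑<-const : ∀ n c → ∑[ _ < n ] c ≡ n * c
∑<-const zero    c = refl
∑<-const (suc n) c = cong (c +_) (∑<-const n c)

∑<-zero : ∀ n {f : ℕ → ℕ} → (∀ y → y < n → f y ≡ 0) → ∑< n f ≡ 0
∑<-zero n f≗0 = trans (∑<-cong n f≗0) (trans (∑<-const n 0) (*-zeroʳ n))

∑<-distrib-+ : ∀ n (f g : ℕ → ℕ) → ∑[ y < n ] (f y + g y) ≡ ∑< n f + ∑< n g
∑<-distrib-+ zero    f g = refl
∑<-distrib-+ (suc n) f g =
  trans (cong (f 0 + g 0 +_) (∑<-distrib-+ n (f ∘ suc) (g ∘ suc))) (interchange (f 0) (g 0) _ _)

∑<-pairs : ∀ m (f : ℕ → ℕ) → ∑< (m * 2) f ≡ ∑[ j < m ] (f (j * 2) + f (suc (j * 2)))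
∑<-pairs zero    f = refl
∑<-pairs (suc m) f = trans (sym (+-assoc (f 0) (f 1) _)) (cong (f 0 + f 1 +_) (∑<-pairs m (f ∘ suc ∘ suc)))

∑<-when : ∀ n b (f : ℕ → ℕ) → ∑[ y < n ] when b (f y) ≡ when b (∑< n f)
∑<-when n true  f = refl
∑<-when n false f = ∑<-zero n (λ _ _ → refl)

∑<-δˡ : ∀ n c (f : ℕ → ℕ) → c < n → ∑[ y < n ] when (y ≡ᵇ c) (f y) ≡ f c
∑<-δˡ (suc n) zero    f _         = trans (cong (f 0 +_) (∑<-zero n (λ _ _ → refl))) (+-identityʳ (f 0))
∑<-δˡ (suc n) (suc c) f (s<s c<n) = ∑<-δˡ n c (f ∘ suc) c<n

∑<-δʳ : ∀ n c (f : ℕ → ℕ) → c < n → ∑[ y < n ] when (c ≡ᵇ y) (f y) ≡ f c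
∑<-δʳ n c f c<n = trans (∑<-cong n (λ y _ → cong (λ b → when b (f y)) (≡ᵇ-sym c y))) (∑<-δˡ n c f c<n)

sum-tabulate : ∀ n (f : ℕ → ℕ) → sum (tabulate {n = n} (f ∘ toℕ)) ≡ ∑< n f
sum-tabulate zero    f = refl
sum-tabulate (suc n) f = cong (f 0 +_) (sum-tabulate n (f ∘ suc))

sum-allFin : ∀ n (f : ℕ → ℕ) → sum (map (f ∘ toℕ) (allFin n)) ≡ ∑< n f
sum-allFin n f = trans (cong sum (LP.map-tabulate {n = n} id (f ∘ toℕ))) (sum-tabulate n f)

extend : ∀ {n} → (Fin n → ℕ) → ℕ → ℕ
extend {n} f y with y <? n
... | yes y<n = f (fromℕ< y<n)
... | no  _   = 0

extend-fromℕ< : ∀ {n} (f : Fin n → ℕ) {y} (y<n : y < n) → extend f y ≡ f (fromℕ< y<n)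
extend-fromℕ< {n} f {y} y<n with y <? n
... | yes _   = cong f (FinP.fromℕ<-cong y y refl _ y<n)
... | no  y≮n = contradiction y<n y≮n

extend-toℕ : ∀ {n} (f : Fin n → ℕ) i → extend f (toℕ i) ≡ f i
extend-toℕ f i = trans (extend-fromℕ< f (FinP.toℕ<n i)) (cong f (FinP.fromℕ<-toℕ i _))

sum-allFin-extend : ∀ n (g : ℕ → ℕ → ℕ) (f : Fin n → ℕ) →
  sum (map (λ i → g (toℕ i) (f i)) (allFin n)) ≡ ∑[ y < n ] g y (extend f y)
sum-allFin-extend n g f =
  trans (cong sum (LP.map-cong (λ i → cong (g (toℕ i)) (sym (extend-toℕ f i))) (allFin n)))
        (sum-allFin n (λ y → g y (extend f y)))

sum-map-distrib-+ : ∀ {a} {A : Set a} (f g : A → ℕ) xs →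
  sum (map (λ x → f x + g x) xs) ≡ sum (map f xs) + sum (map g xs)
sum-map-distrib-+ f g []       = refl
sum-map-distrib-+ f g (x ∷ xs) =
  trans (cong (f x + g x +_) (sum-map-distrib-+ f g xs)) (interchange (f x) (g x) _ _)

sum-map-comm : ∀ {a b} {A : Set a} {B : Set b} (f : A → B → ℕ) xs ys →
  sum (map (λ x → sum (map (f x) ys)) xs) ≡ sum (map (λ y → sum (map (λ x → f x y) xs)) ys)
sum-map-comm f []       ys = sym (sum-map-zero ys)
  where
  sum-map-zero : ∀ {b} {B : Set b} (ys : List B) → sum (map (λ _ → 0) ys) ≡ 0
  sum-map-zero []       = refl
  sum-map-zero (_ ∷ ys) = sum-map-zero ys
sum-map-comm f (x ∷ xs) ys =
  trans (cong (sum (map (f x) ys) +_) (sum-map-comm f xs ys)) (sym (sum-map-distrib-+ (f x) _ ys))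

when-sum-map : ∀ {a} {A : Set a} b (f : A → ℕ) xs → when b (sum (map f xs)) ≡ sum (map (λ x → when b (f x)) xs)
when-sum-map true  f xs       = refl
when-sum-map false f []       = refl
when-sum-map false f (x ∷ xs) = when-sum-map false f xs

sum-map-filter : ∀ {a p} {A : Set a} {P : A → Set p} (P? : ∀ x → Dec (P x)) (f : A → ℕ) xs →
  sum (map f (filter P? xs)) ≡ sum (map (λ x → when (does (P? x)) (f x)) xs)
sum-map-filter P? f []       = refl
sum-map-filter P? f (x ∷ xs) with does (P? x)
... | true  = cong (f x +_) (sum-map-filter P? f xs)
... | false = sum-map-filter P? f xs

sum-map-concatMap : ∀ {a b} {A : Set a} {B : Set b} (f : B → ℕ) (g : A → List B) xs →
  sum (map f (concatMap g xs)) ≡ sum (map (λ x → sum (map f (g x))) xs)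
sum-map-concatMap f g []       = refl
sum-map-concatMap f g (x ∷ xs) = begin
  sum (map f (g x ++ concatMap g xs))              ≡⟨ cong sum (LP.map-++ f (g x) _) ⟩
  sum (map f (g x) ++ map f (concatMap g xs))      ≡⟨ sum-++ (map f (g x)) _ ⟩
  sum (map f (g x)) + sum (map f (concatMap g xs)) ≡⟨ cong (sum (map f (g x)) +_) (sum-map-concatMap f g xs) ⟩
  sum (map f (g x)) + sum (map (λ x → sum (map f (g x))) xs) ∎
  where open ≡-Reasoning

sum-map-lookup : ∀ {a} {A : Set a} (f : A → ℕ) (xs : List A) →
  sum (map (f ∘ lookup xs) (allFin (length xs))) ≡ sum (map f xs)
sum-map-lookup f xs = cong sum (begin
  map (f ∘ lookup xs) (allFin (length xs)) ≡⟨ LP.map-tabulate id (f ∘ lookup xs) ⟩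
  tabulate (f ∘ lookup xs)                 ≡⟨ LP.map-tabulate (lookup xs) f ⟨
  map f (tabulate (lookup xs))             ≡⟨ cong (map f) (LP.tabulate-lookup xs) ⟩
  map f xs                                 ∎)
  where open ≡-Reasoning

does≡true⇒ : ∀ {p} {P : Set p} (P? : Dec P) → does P? ≡ true → P
does≡true⇒ (yes p) _ = p

Fin-≟-≡ᵇ : ∀ {n} (i j : Fin n) → does (i Fin.≟ j) ≡ (toℕ i ≡ᵇ toℕ j)
Fin-≟-≡ᵇ Fin.zero    Fin.zero    = refl
Fin-≟-≡ᵇ Fin.zero    (Fin.suc j) = refl
Fin-≟-≡ᵇ (Fin.suc i) Fin.zero    = refl
Fin-≟-≡ᵇ (Fin.suc i) (Fin.suc j) = Fin-≟-≡ᵇ i j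

sum-allFin² : ∀ n (f : ℕ → ℕ → ℕ) →
  sum (map (λ i → sum (map (λ j → f (toℕ i) (toℕ j)) (allFin n))) (allFin n)) ≡ ∑[ u < n ] ∑[ v < n ] f u v
sum-allFin² n f = trans (cong sum (LP.map-cong (λ i → sum-allFin n (f (toℕ i))) (allFin n)))
                        (sum-allFin n (λ u → ∑< n (f u)))

allPairs : (G : Graph) → List (Fin (nv G) × Fin (nv G))
allPairs G = concatMap (λ u → map (u ,_) (allFin (nv G))) (allFin (nv G))

isEdge? : (G : Graph) (p : Fin (nv G) × Fin (nv G)) → Dec ((proj₁ p Fin.< proj₂ p) × Adj G (proj₁ p) (proj₂ p))
isEdge? G p = (proj₁ p Fin.<? proj₂ p) ×-dec adj? G (proj₁ p) (proj₂ p)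

edge-ordered-adjacent : (G : Graph) (k : Fin (nE G)) →
  (proj₁ (edge G k) Fin.< proj₂ (edge G k)) × Adj G (proj₁ (edge G k)) (proj₂ (edge G k))
edge-ordered-adjacent G k = proj₂ (∈-filter⁻ (isEdge? G) {xs = allPairs G} (∈-lookup k))

edge-of-adjacent : (G : Graph) {u v : Fin (nv G)} → u Fin.< v → Adj G u v → ∃ λ k → edge G k ≡ (u , v)
edge-of-adjacent G {u} {v} u<v uv = index uv∈edges , sym (lookup-index uv∈edges)
  where
  uv∈edges : (u , v) ∈ edges G
  uv∈edges = ∈-filter⁺ (isEdge? G) (∈-concatMap⁺ (λ w → map (w ,_) (allFin (nv G))) (lose (∈-allFin u) (∈-map⁺ (u ,_) (∈-allFin v)))) (u<v , uv)

onEdge : (G : Graph) → (ℕ → ℕ → ℕ) → Fin (nE G) → ℕ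
onEdge G φ k = φ (toℕ (proj₁ (edge G k))) (toℕ (proj₂ (edge G k)))

double-counting : (G : Graph) (w : Fin (nE G) → ℕ) (P : ℕ → Bool) →
  sum (map (λ x → when (P (toℕ x)) (sum (map (λ k → when (incident G x k) (w k)) (allFin (nE G))))) (allFin (nv G)))
  ≡ sum (map (λ k → onEdge G (λ a b → when (P a) (w k) + when (P b) (w k)) k) (allFin (nE G)))
double-counting G w P = begin
  sum (map (λ x → when (P (toℕ x)) (sum (map (λ k → when (incident G x k) (w k)) (allFin (nE G))))) (allFin N))
    ≡⟨ cong sum (LP.map-cong (λ x → when-sum-map (P (toℕ x)) _ (allFin (nE G))) (allFin N)) ⟩
  sum (map (λ x → sum (map (λ k → when (P (toℕ x)) (when (incident G x k) (w k))) (allFin (nE G)))) (allFin N))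
    ≡⟨ sum-map-comm (λ x k → when (P (toℕ x)) (when (incident G x k) (w k))) (allFin N) (allFin (nE G)) ⟩
  sum (map (λ k → sum (map (λ x → when (P (toℕ x)) (when (incident G x k) (w k))) (allFin N))) (allFin (nE G)))
    ≡⟨ cong sum (LP.map-cong edgeTerm (allFin (nE G))) ⟩
  sum (map (λ k → onEdge G (λ a b → when (P a) (w k) + when (P b) (w k)) k) (allFin (nE G))) ∎
  where
  open ≡-Reasoning
  N = nv G
  edgeTerm : ∀ k → sum (map (λ x → when (P (toℕ x)) (when (incident G x k) (w k))) (allFin N))
                   ≡ onEdge G (λ a b → when (P a) (w k) + when (P b) (w k)) k
  edgeTerm k = begin
    sum (map (λ x → when (P (toℕ x)) (when (incident G x k) (w k))) (allFin N))
      ≡⟨ cong sum (LP.map-cong (λ x → cong₂ (λ b c → when (P (toℕ x)) (when (b ∨ c) (w k))) (Fin-≟-≡ᵇ u x) (Fin-≟-≡ᵇ v x)) (allFin N)) ⟩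
    sum (map (λ x → when (P (toℕ x)) (when ((a ≡ᵇ toℕ x) ∨ (b ≡ᵇ toℕ x)) (w k))) (allFin N))
      ≡⟨ sum-allFin N (λ y → when (P y) (when ((a ≡ᵇ y) ∨ (b ≡ᵇ y)) (w k))) ⟩
    ∑[ y < N ] when (P y) (when ((a ≡ᵇ y) ∨ (b ≡ᵇ y)) (w k))
      ≡⟨ ∑<-cong N (λ y _ → trans (when-comm (P y) _ (w k)) (when-≡ᵇ-∨ a b y _ a≢b)) ⟩
    ∑[ y < N ] (when (a ≡ᵇ y) (when (P y) (w k)) + when (b ≡ᵇ y) (when (P y) (w k)))
      ≡⟨ ∑<-distrib-+ N _ _ ⟩
    ∑[ y < N ] when (a ≡ᵇ y) (when (P y) (w k)) + ∑[ y < N ] when (b ≡ᵇ y) (when (P y) (w k))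
      ≡⟨ cong₂ _+_ (∑<-δʳ N a (λ y → when (P y) (w k)) (FinP.toℕ<n u)) (∑<-δʳ N b (λ y → when (P y) (w k)) (FinP.toℕ<n v)) ⟩
    when (P a) (w k) + when (P b) (w k) ∎
    where
    u = proj₁ (edge G k)
    v = proj₂ (edge G k)
    a = toℕ u
    b = toℕ v
    a≢b : a ≢ b
    a≢b = <⇒≢ (proj₁ (edge-ordered-adjacent G k))

∑-side≡∑-labels : (G : Graph) (L : Labeling G) (P : ℕ → Bool) →
  (∀ k → P (toℕ (proj₂ (edge G k))) ≡ not (P (toℕ (proj₁ (edge G k))))) →
  sum (map (λ x → when (P (toℕ x)) (vsum L x)) (allFin (nv G))) ≡ sum (map (label L) (allFin (nE G)))
∑-side≡∑-labels G L P separates = trans (double-counting G (label L) P) (cong sum (LP.map-cong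
  (λ k → trans (cong (λ b → when (P (toℕ (proj₁ (edge G k)))) (label L k) + when b (label L k)) (separates k))
               (when-not (P (toℕ (proj₁ (edge G k)))) (label L k)))
  (allFin (nE G))))

module IncidentSums (G : Graph) (A : ℕ → ℕ → Bool) (adj?≡A : ∀ u v → does (adj? G u v) ≡ A (toℕ u) (toℕ v))
  (A-sym : ∀ u v → A u v ≡ A v u) (A-irrefl : ∀ u → A u u ≡ false) where

  private
    N = nv G

  sum-onEdge : (φ : ℕ → ℕ → ℕ) →
    sum (map (onEdge G φ) (allFin (nE G))) ≡ ∑[ u < N ] ∑[ v < N ] when ((u <ᵇ v) ∧ A u v) (φ u v)
  sum-onEdge φ = begin
    sum (map (ψ ∘ lookup (edges G)) (allFin (nE G)))                                   ≡⟨ sum-map-lookup ψ (edges G) ⟩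
    sum (map ψ (edges G))                                                               ≡⟨ sum-map-filter (isEdge? G) ψ (allPairs G) ⟩
    sum (map (λ p → when (does (isEdge? G p)) (ψ p)) (allPairs G))                      ≡⟨ sum-map-concatMap _ _ (allFin N) ⟩
    sum (map (λ u → sum (map (λ p → when (does (isEdge? G p)) (ψ p)) (map (u ,_) (allFin N)))) (allFin N))
      ≡⟨ cong sum (LP.map-cong (λ u → cong sum (trans (sym (LP.map-∘ (allFin N)))
           (LP.map-cong (λ v → cong (λ b → when ((toℕ u <ᵇ toℕ v) ∧ b) (ψ (u , v))) (adj?≡A u v)) (allFin N))))
         (allFin N)) ⟩
    sum (map (λ u → sum (map (λ v → when ((toℕ u <ᵇ toℕ v) ∧ A (toℕ u) (toℕ v)) (φ (toℕ u) (toℕ v))) (allFin N))) (allFin N))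
      ≡⟨ sum-allFin² N (λ u v → when ((u <ᵇ v) ∧ A u v) (φ u v)) ⟩
    ∑[ u < N ] ∑[ v < N ] when ((u <ᵇ v) ∧ A u v) (φ u v) ∎
    where
    open ≡-Reasoning
    ψ : Fin N × Fin N → ℕ
    ψ (u , v) = φ (toℕ u) (toℕ v)

  when-incident-split : ∀ (W : ℕ → ℕ → ℕ) x u v →
    when ((u <ᵇ v) ∧ A u v) (when ((u ≡ᵇ x) ∨ (v ≡ᵇ x)) (W u v))
    ≡ when (u ≡ᵇ x) (when ((x <ᵇ v) ∧ A x v) (W x v)) + when (v ≡ᵇ x) (when ((u <ᵇ x) ∧ A u x) (W u x))
  when-incident-split W x u v with u ≡ᵇ x in u≡x | v ≡ᵇ x in v≡x
  ... | true | true with refl ← ≡ᵇ-true⇒≡ u x u≡x | refl ← ≡ᵇ-true⇒≡ v x v≡x rewrite <ᵇ-irrefl u = refl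
  ... | true | false with refl ← ≡ᵇ-true⇒≡ u x u≡x with (u <ᵇ v) ∧ A u v
  ...   | true  = sym (+-identityʳ _)
  ...   | false = refl
  when-incident-split W x u v | false | true with refl ← ≡ᵇ-true⇒≡ v x v≡x with (u <ᵇ v) ∧ A u v
  ...   | true  = refl
  ...   | false = refl
  when-incident-split W x u v | false | false with (u <ᵇ v) ∧ A u v
  ...   | true  = refl
  ...   | false = refl

  when-both-orientations : ∀ (W : ℕ → ℕ → ℕ) x v → (A x v ≡ true → W x v ≡ W v x) →
    when ((x <ᵇ v) ∧ A x v) (W x v) + when ((v <ᵇ x) ∧ A v x) (W v x) ≡ when (A x v) (W x v)
  when-both-orientations W x v W-sym with A x v in xv
  ... | false rewrite A-sym v x | xv | ∧-zeroʳ (x <ᵇ v) | ∧-zeroʳ (v <ᵇ x) = refl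
  ... | true rewrite A-sym v x | xv | ∧-identityʳ (x <ᵇ v) | ∧-identityʳ (v <ᵇ x) with x ≡ᵇ v in x≡v
  ...   | true with refl ← ≡ᵇ-true⇒≡ x v x≡v = contradiction (trans (sym xv) (A-irrefl x)) λ ()
  ...   | false with x <ᵇ v in x<v
  ...     | true  rewrite <ᵇ-asym x v x<v = +-identityʳ _
  ...     | false rewrite <ᵇ-trichotomy x v x≡v x<v = sym (W-sym refl)

  ∑-incident≡∑-adjacent : (W : ℕ → ℕ → ℕ) → (∀ u v → u < N → v < N → A u v ≡ true → W u v ≡ W v u) →
    (x : Fin N) → sum (map (λ k → when (incident G x k) (onEdge G W k)) (allFin (nE G)))
                  ≡ ∑[ v < N ] when (A (toℕ x) v) (W (toℕ x) v)
  ∑-incident≡∑-adjacent W W-sym x = begin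
    sum (map (λ k → when (incident G x k) (onEdge G W k)) (allFin (nE G)))
      ≡⟨ cong sum (LP.map-cong (λ k → cong₂ (λ b c → when (b ∨ c) (onEdge G W k))
           (Fin-≟-≡ᵇ (proj₁ (edge G k)) x) (Fin-≟-≡ᵇ (proj₂ (edge G k)) x)) (allFin (nE G))) ⟩
    sum (map (onEdge G (λ u v → when ((u ≡ᵇ n) ∨ (v ≡ᵇ n)) (W u v))) (allFin (nE G)))
      ≡⟨ sum-onEdge (λ u v → when ((u ≡ᵇ n) ∨ (v ≡ᵇ n)) (W u v)) ⟩
    ∑[ u < N ] ∑[ v < N ] when ((u <ᵇ v) ∧ A u v) (when ((u ≡ᵇ n) ∨ (v ≡ᵇ n)) (W u v))
      ≡⟨ ∑<-cong N (λ u _ → trans (∑<-cong N (λ v _ → when-incident-split W n u v)) (∑<-distrib-+ N _ _)) ⟩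
    ∑[ u < N ] (∑[ v < N ] when (u ≡ᵇ n) (out v) + ∑[ v < N ] when (v ≡ᵇ n) (into u))
      ≡⟨ ∑<-cong N (λ u _ → cong₂ _+_ (∑<-when N (u ≡ᵇ n) out) (∑<-δˡ N n (λ _ → into u) n<N)) ⟩
    ∑[ u < N ] (when (u ≡ᵇ n) (∑< N out) + into u)
      ≡⟨ ∑<-distrib-+ N _ _ ⟩
    ∑[ u < N ] when (u ≡ᵇ n) (∑< N out) + ∑< N into
      ≡⟨ cong (_+ ∑< N into) (∑<-δˡ N n (λ _ → ∑< N out) n<N) ⟩
    ∑< N out + ∑< N into
      ≡⟨ ∑<-distrib-+ N out into ⟨
    ∑[ v < N ] (out v + into v)
      ≡⟨ ∑<-cong N (λ v v<N → when-both-orientations W n v (W-sym n v n<N v<N)) ⟩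
    ∑[ v < N ] when (A n v) (W n v) ∎
    where
    open ≡-Reasoning
    n = toℕ x
    n<N = FinP.toℕ<n x
    out into : ℕ → ℕ
    out  v = when ((n <ᵇ v) ∧ A n v) (W n v)
    into u = when ((u <ᵇ n) ∧ A u n) (W u n)

-- The cycle C_m and its blow-up C_m[O_2]

⌊n*2/2⌋≡n : ∀ n → ⌊ n * 2 /2⌋ ≡ n
⌊n*2/2⌋≡n zero    = refl
⌊n*2/2⌋≡n (suc n) = cong suc (⌊n*2/2⌋≡n n)

⌊1+n*2/2⌋≡n : ∀ n → ⌊ suc (n * 2) /2⌋ ≡ n
⌊1+n*2/2⌋≡n zero    = refl
⌊1+n*2/2⌋≡n (suc n) = cong suc (⌊1+n*2/2⌋≡n n)

⌊n/2⌋<m : ∀ m n → n < m * 2 → ⌊ n /2⌋ < m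
⌊n/2⌋<m (suc m) zero          _                 = z<s
⌊n/2⌋<m (suc m) (suc zero)    _                 = z<s
⌊n/2⌋<m (suc m) (suc (suc n)) (s<s (s<s n<2m)) = s<s (⌊n/2⌋<m m n n<2m)

∑<-pairs-when : ∀ m (P : ℕ → Bool) (f : ℕ → ℕ) →
  ∑[ y < m * 2 ] when (P ⌊ y /2⌋) (f y) ≡ ∑[ j < m ] when (P j) (f (j * 2) + f (suc (j * 2)))
∑<-pairs-when m P f = trans (∑<-pairs m _) (∑<-cong m (λ j _ → trans
  (cong₂ (λ a b → when (P a) (f (j * 2)) + when (P b) (f (suc (j * 2)))) (⌊n*2/2⌋≡n j) (⌊1+n*2/2⌋≡n j))
  (when-distrib-+ (P j) _ _)))

copy : ℕ → ℕ
copy zero          = 0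
copy (suc zero)    = 1
copy (suc (suc n)) = copy n

copy≤1 : ∀ n → copy n ≤ 1
copy≤1 zero          = z≤n
copy≤1 (suc zero)    = s≤s z≤n
copy≤1 (suc (suc n)) = copy≤1 n

⌊n/2⌋*2+copy≡n : ∀ n → ⌊ n /2⌋ * 2 + copy n ≡ n
⌊n/2⌋*2+copy≡n zero          = refl
⌊n/2⌋*2+copy≡n (suc zero)    = refl
⌊n/2⌋*2+copy≡n (suc (suc n)) = cong (suc ∘ suc) (⌊n/2⌋*2+copy≡n n)

copy-*2 : ∀ n → copy (n * 2) ≡ 0
copy-*2 zero    = refl
copy-*2 (suc n) = copy-*2 n

copy-1+*2 : ∀ n → copy (suc (n * 2)) ≡ 1
copy-1+*2 zero    = refl
copy-1+*2 (suc n) = copy-1+*2 n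

layer-copy : ∀ i s → s ≤ 1 → ⌊ i * 2 + s /2⌋ ≡ i × copy (i * 2 + s) ≡ s
layer-copy i zero       _ rewrite +-identityʳ (i * 2) = ⌊n*2/2⌋≡n i , copy-*2 i
layer-copy i (suc zero) _ rewrite +-comm (i * 2) 1     = ⌊1+n*2/2⌋≡n i , copy-1+*2 i
layer-copy i (suc (suc s)) (s≤s ())

i*d+s<m*d : ∀ {m d} i s → i < m → s < d → i * d + s < m * d
i*d+s<m*d {m} {d} i s i<m s<d = begin-strict
  i * d + s  <⟨ +-monoʳ-< (i * d) s<d ⟩
  i * d + d  ≡⟨ +-comm (i * d) d ⟩
  suc i * d  ≤⟨ *-monoˡ-≤ d i<m ⟩
  m * d      ∎
  where open ≤-Reasoning

isEven : ℕ → Bool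
isEven zero    = true
isEven (suc n) = not (isEven n)

isEven-*2 : ∀ n → isEven (n * 2) ≡ true
isEven-*2 zero    = refl
isEven-*2 (suc n) = trans (not-involutive (isEven (n * 2))) (isEven-*2 n)

∑<-when-isEven : ∀ h c → ∑[ j < h * 2 ] when (isEven j) c ≡ h * c
∑<-when-isEven h c = trans (∑<-pairs h _) (trans (∑<-cong h (λ j _ → pair j)) (∑<-const h c))
  where
  pair : ∀ j → when (isEven (j * 2)) c + when (not (isEven (j * 2))) c ≡ c
  pair j rewrite isEven-*2 j = +-identityʳ c

∑<-when-isOdd : ∀ h c → ∑[ j < h * 2 ] when (not (isEven j)) c ≡ h * c
∑<-when-isOdd h c = trans (∑<-pairs h _) (trans (∑<-cong h (λ j _ → pair j)) (∑<-const h c))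
  where
  pair : ∀ j → when (not (isEven (j * 2))) c + when (not (not (isEven (j * 2)))) c ≡ c
  pair j rewrite isEven-*2 j = refl

cycleStep : ℕ → ℕ → ℕ → Bool
cycleStep m i j = (suc i ≡ᵇ j) ∨ ((i ≡ᵇ 0) ∧ (suc j ≡ᵇ m))

cycleAdj : ℕ → ℕ → ℕ → Bool
cycleAdj m i j = cycleStep m i j ∨ cycleStep m j i

cycleAdj-suc : ∀ m i → cycleAdj m i (suc i) ≡ true
cycleAdj-suc m i rewrite ≡ᵇ-refl i = refl

next : ℕ → ℕ → ℕ
next m i = if suc i ≡ᵇ m then 0 else suc i

prev : ℕ → ℕ → ℕ
prev m i = if i ≡ᵇ 0 then ℕ.pred m else ℕ.pred i

Blowup : ℕ → Graph
Blowup m = Lex (Cycle m) (Empty 2)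

-- Lex numbers the vertex (i , s) of C_m[O_2] as combine i s, that is 2i + s.
layer-remQuot : ∀ m (x : Fin (m * 2)) → toℕ (proj₁ (remQuot {m} 2 x)) ≡ ⌊ toℕ x /2⌋
layer-remQuot m x = begin
  toℕ i                     ≡⟨ proj₁ (layer-copy (toℕ i) (toℕ s) (ℕ.s≤s⁻¹ (FinP.toℕ<n s))) ⟨
  ⌊ toℕ i * 2 + toℕ s /2⌋   ≡⟨ cong (λ z → ⌊ z + toℕ s /2⌋) (*-comm (toℕ i) 2) ⟩
  ⌊ 2 * toℕ i + toℕ s /2⌋   ≡⟨ cong ⌊_/2⌋ (FinP.toℕ-combine i s) ⟨
  ⌊ toℕ (Fin.combine i s) /2⌋ ≡⟨ cong (λ z → ⌊ toℕ z /2⌋) (FinP.combine-remQuot {m} 2 x) ⟩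
  ⌊ toℕ x /2⌋               ∎
  where
  open ≡-Reasoning
  i = proj₁ (remQuot {m} 2 x)
  s = proj₂ (remQuot {m} 2 x)

Blowup-adj? : ∀ m (x y : Fin (m * 2)) → does (adj? (Blowup m) x y) ≡ cycleAdj m ⌊ toℕ x /2⌋ ⌊ toℕ y /2⌋
Blowup-adj? m x y
  rewrite ∧-zeroʳ (does (proj₁ (remQuot {m} 2 x) Fin.≟ proj₁ (remQuot {m} 2 y)))
        | ∨-identityʳ (cycleAdj m (toℕ (proj₁ (remQuot {m} 2 x))) (toℕ (proj₁ (remQuot {m} 2 y))))
        | layer-remQuot m x | layer-remQuot m y = refl

module CycleNeighbours (m′ : ℕ) where

  m : ℕ
  m = suc (suc (suc m′))

  cycleAdj-next-prev : ∀ i j → j < m → cycleAdj m i j ≡ (next m i ≡ᵇ j) ∨ (prev m i ≡ᵇ j)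
  cycleAdj-next-prev zero j j<m
    rewrite ∧-zeroʳ (j ≡ᵇ 0) | ∨-identityʳ ((1 ≡ᵇ j) ∨ (j ≡ᵇ suc (suc m′))) | ≡ᵇ-sym j (suc (suc m′)) = refl
  cycleAdj-next-prev (suc i) j j<m with suc (suc i) ≡ᵇ m in e
  ... | true with refl ← ≡ᵇ-true⇒≡ i (suc m′) e
    rewrite ≢⇒≡ᵇ-false m j (λ m≡j → <-irrefl (sym m≡j) j<m) | ≡ᵇ-sym j (suc m′) | ≡ᵇ-sym j 0 | ∧-identityʳ (0 ≡ᵇ j)
    = ∨-comm (suc m′ ≡ᵇ j) (0 ≡ᵇ j)
  ... | false rewrite ∨-identityʳ (suc (suc i) ≡ᵇ j) | ∧-zeroʳ (j ≡ᵇ 0) | ∨-identityʳ (j ≡ᵇ i) | ≡ᵇ-sym j i = refl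

  cycleAdj⇒next⊎prev : ∀ i j → j < m → cycleAdj m i j ≡ true → j ≡ next m i ⊎ j ≡ prev m i
  cycleAdj⇒next⊎prev i j j<m ij with next m i ≡ᵇ j in e₁ | prev m i ≡ᵇ j in e₂ | trans (sym (cycleAdj-next-prev i j j<m)) ij
  ... | true  | _    | _ = inj₁ (sym (≡ᵇ-true⇒≡ (next m i) j e₁))
  ... | false | true | _ = inj₂ (sym (≡ᵇ-true⇒≡ (prev m i) j e₂))

  next<m : ∀ i → i < m → next m i < m
  next<m i i<m with suc i ≡ᵇ m in e
  ... | true  = z<s
  ... | false = ≤∧≢⇒< i<m (≡ᵇ-false⇒≢ (suc i) m e)

  prev<m : ∀ i → i < m → prev m i < m
  prev<m zero    _   = ≤-refl
  prev<m (suc i) i<m = <-trans (n<1+n i) i<m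

  next≢prev : ∀ i → next m i ≢ prev m i
  next≢prev zero ()
  next≢prev (suc i) with suc (suc i) ≡ᵇ m in e
  ... | true  = λ 0≡i → 0≢1+n (trans 0≡i (suc-injective (suc-injective (≡ᵇ-true⇒≡ (suc (suc i)) m e))))
  ... | false = λ 2+i≡i → <-irrefl (sym 2+i≡i) (<-trans (n<1+n i) (n<1+n (suc i)))

  next-prev : ∀ i → i < m → next m (prev m i) ≡ i
  next-prev zero    _   rewrite ≡ᵇ-refl m′ = refl
  next-prev (suc i) i<m with suc i ≡ᵇ m in e
  ... | true  = contradiction (≡ᵇ-true⇒≡ (suc i) m e) (<⇒≢ i<m)
  ... | false = refl

  prev-next : ∀ i → prev m (next m i) ≡ i
  prev-next i with suc i ≡ᵇ m in e
  ... | true  = suc-injective (sym (≡ᵇ-true⇒≡ (suc i) m e))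
  ... | false = refl

  cycleAdj-next : ∀ i → i < m → cycleAdj m i (next m i) ≡ true
  cycleAdj-next i i<m = trans (cycleAdj-next-prev i (next m i) (next<m i i<m)) (cong (_∨ (prev m i ≡ᵇ next m i)) (≡ᵇ-refl (next m i)))

  ∑-cycleAdj : ∀ i → i < m → (f : ℕ → ℕ) → ∑[ j < m ] when (cycleAdj m i j) (f j) ≡ f (next m i) + f (prev m i)
  ∑-cycleAdj i i<m f = begin
    ∑[ j < m ] when (cycleAdj m i j) (f j)
      ≡⟨ ∑<-cong m (λ j j<m → trans (cong (λ b → when b (f j)) (cycleAdj-next-prev i j j<m))
                                     (when-≡ᵇ-∨ (next m i) (prev m i) j (f j) (next≢prev i))) ⟩
    ∑[ j < m ] (when (next m i ≡ᵇ j) (f j) + when (prev m i ≡ᵇ j) (f j))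
      ≡⟨ ∑<-distrib-+ m (λ j → when (next m i ≡ᵇ j) (f j)) (λ j → when (prev m i ≡ᵇ j) (f j)) ⟩
    ∑[ j < m ] when (next m i ≡ᵇ j) (f j) + ∑[ j < m ] when (prev m i ≡ᵇ j) (f j)
      ≡⟨ cong₂ _+_ (∑<-δʳ m (next m i) f (next<m i i<m)) (∑<-δʳ m (prev m i) f (prev<m i i<m)) ⟩
    f (next m i) + f (prev m i) ∎
    where open ≡-Reasoning

  blowupAdj : ℕ → ℕ → Bool
  blowupAdj x y = cycleAdj m ⌊ x /2⌋ ⌊ y /2⌋

  blowupAdj-sym : ∀ x y → blowupAdj x y ≡ blowupAdj y x
  blowupAdj-sym x y = ∨-comm (cycleStep m ⌊ x /2⌋ ⌊ y /2⌋) (cycleStep m ⌊ y /2⌋ ⌊ x /2⌋)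

  cycleStep-irrefl : ∀ i → cycleStep m i i ≡ false
  cycleStep-irrefl zero    = refl
  cycleStep-irrefl (suc i) rewrite ≢⇒≡ᵇ-false (suc (suc i)) (suc i) 1+n≢n = refl

  blowupAdj-irrefl : ∀ x → blowupAdj x x ≡ false
  blowupAdj-irrefl x rewrite cycleStep-irrefl ⌊ x /2⌋ = refl

  ∑-blowupAdj : ∀ x → ⌊ x /2⌋ < m → (f : ℕ → ℕ) →
    ∑[ y < m * 2 ] when (blowupAdj x y) (f y)
    ≡ (f (next m ⌊ x /2⌋ * 2) + f (suc (next m ⌊ x /2⌋ * 2))) + (f (prev m ⌊ x /2⌋ * 2) + f (suc (prev m ⌊ x /2⌋ * 2)))
  ∑-blowupAdj x i<m f = trans (∑<-pairs-when m (cycleAdj m ⌊ x /2⌋) f) (∑-cycleAdj ⌊ x /2⌋ i<m (λ j → f (j * 2) + f (suc (j * 2))))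

module EvenCycle (k : ℕ) where

  h : ℕ
  h = suc (suc k)

  open CycleNeighbours (suc (k * 2)) public

  G : Graph
  G = Blowup m

  N : ℕ
  N = m * 2

  open IncidentSums G blowupAdj (Blowup-adj? m) blowupAdj-sym blowupAdj-irrefl

  isEven-m : isEven m ≡ true
  isEven-m = isEven-*2 h

  isEven-next : ∀ i → isEven (next m i) ≡ not (isEven i)
  isEven-next i with suc i ≡ᵇ m in e
  ... | true  = sym (trans (cong isEven (≡ᵇ-true⇒≡ (suc i) m e)) isEven-m)
  ... | false = refl

  isEven-prev : ∀ i → i < m → isEven (prev m i) ≡ not (isEven i)
  isEven-prev i i<m = ≡not⇒≡not (subst (λ z → isEven z ≡ not (isEven (prev m i))) (next-prev i i<m) (isEven-next (prev m i)))

  cycleAdj⇒parity : ∀ i j → i < m → j < m → cycleAdj m i j ≡ true → isEven j ≡ not (isEven i)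
  cycleAdj⇒parity i j i<m j<m ij with cycleAdj⇒next⊎prev i j j<m ij
  ... | inj₁ refl = isEven-next i
  ... | inj₂ refl = isEven-prev i i<m

  adj⇒blowupAdj : ∀ x y → Adj G x y → blowupAdj (toℕ x) (toℕ y) ≡ true
  adj⇒blowupAdj x y xy = trans (sym (Blowup-adj? m x y)) (dec-true (adj? G x y) xy)

  blowupAdj⇒adj : ∀ {y y′} (y<N : y < N) (y′<N : y′ < N) → blowupAdj y y′ ≡ true → Adj G (fromℕ< y<N) (fromℕ< y′<N)
  blowupAdj⇒adj {y} {y′} y<N y′<N yy′ = does≡true⇒ (adj? G (fromℕ< y<N) (fromℕ< y′<N)) (begin
    does (adj? G (fromℕ< y<N) (fromℕ< y′<N)) ≡⟨ Blowup-adj? m (fromℕ< y<N) (fromℕ< y′<N) ⟩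
    blowupAdj (toℕ (fromℕ< y<N)) (toℕ (fromℕ< y′<N)) ≡⟨ cong₂ blowupAdj (FinP.toℕ-fromℕ< y<N) (FinP.toℕ-fromℕ< y′<N) ⟩
    blowupAdj y y′ ≡⟨ yy′ ⟩
    true ∎)
    where open ≡-Reasoning

  layer<m : (x : Fin N) → ⌊ toℕ x /2⌋ < m
  layer<m x = ⌊n/2⌋<m m (toℕ x) (FinP.toℕ<n x)

  adj⇒parity : ∀ x y → Adj G x y → isEven ⌊ toℕ y /2⌋ ≡ not (isEven ⌊ toℕ x /2⌋)
  adj⇒parity x y xy = cycleAdj⇒parity _ _ (layer<m x) (layer<m y) (adj⇒blowupAdj x y xy)

  -- Lower bound

  module TwoColouring (V : ℕ → ℕ) {a b : ℕ} (two-valued : ∀ y → y < N → V y ≡ a ⊎ V y ≡ b)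
    (proper : ∀ {y y′} → y < N → y′ < N → blowupAdj y y′ ≡ true → V y ≢ V y′) where

    -- vertex 0 lies in layer 0 and vertex 2 in layer 1
    colour : Bool → ℕ
    colour true  = V 0
    colour false = V 2

    2<N : 2 < N
    2<N = s≤s (s≤s (s≤s z≤n))

    colours-differ : V 0 ≢ V 2
    colours-differ = proper (<-trans z<s 2<N) 2<N refl

    two-colours : ∀ y → y < N → V y ≡ V 0 ⊎ V y ≡ V 2
    two-colours y y<N = pair-switch (two-valued 0 (<-trans z<s 2<N)) (two-valued 2 2<N) colours-differ (two-valued y y<N)

    other-colour : ∀ y e → y < N → V y ≢ colour e → V y ≡ colour (not e)
    other-colour y e y<N y≢e with two-colours y y<N | e
    ... | inj₁ y≡0 | true  = contradiction y≡0 y≢e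
    ... | inj₁ y≡0 | false = y≡0
    ... | inj₂ y≡2 | true  = y≡2
    ... | inj₂ y≡2 | false = contradiction y≡2 y≢e

    colour-by-layer : ∀ j y → y < N → ⌊ y /2⌋ ≡ j → V y ≡ colour (isEven j)
    colour-by-layer zero y y<N y∈0 with two-colours y y<N
    ... | inj₁ y≡0 = y≡0
    ... | inj₂ y≡2 = contradiction y≡2 (proper y<N 2<N (cong (λ i → cycleAdj m i 1) y∈0))
    colour-by-layer (suc j) y y<N y∈j+1 = other-colour y (isEven j) y<N λ y≡j → proper j*2<N y<N
      (trans (cong₂ (cycleAdj m) (⌊n*2/2⌋≡n j) y∈j+1) (cycleAdj-suc m j))
      (trans (colour-by-layer j (j * 2) j*2<N (⌊n*2/2⌋≡n j)) (sym y≡j))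
      where
      j*2<N : j * 2 < N
      j*2<N = *-monoˡ-< 2 (<-trans (n<1+n j) (subst (_< m) y∈j+1 (⌊n/2⌋<m m y y<N)))

    ∑-coloured-layers : (P : ℕ → Bool) (e : Bool) → (∀ j → P j ≡ true → isEven j ≡ e) →
      ∑[ y < N ] when (P ⌊ y /2⌋) (V y) ≡ ∑[ j < m ] when (P j) (colour e + colour e)
    ∑-coloured-layers P e P⇒e = trans (∑<-cong N pointwise) (∑<-pairs-when m P (λ _ → colour e))
      where
      pointwise : ∀ y → y < N → when (P ⌊ y /2⌋) (V y) ≡ when (P ⌊ y /2⌋) (colour e)
      pointwise y y<N with P ⌊ y /2⌋ in Py
      ... | true  = trans (colour-by-layer ⌊ y /2⌋ y y<N refl) (cong colour (P⇒e _ Py))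
      ... | false = refl

    unbalanced : ∑[ y < N ] when (isEven ⌊ y /2⌋) (V y) ≢ ∑[ y < N ] when (not (isEven ⌊ y /2⌋)) (V y)
    unbalanced balanced = colours-differ (m+m≡n+n⇒m≡n _ _ (*-cancelˡ-≡ _ _ h (begin
      h * (V 0 + V 0)                                  ≡⟨ ∑<-when-isEven h (V 0 + V 0) ⟨
      ∑[ j < m ] when (isEven j) (V 0 + V 0)           ≡⟨ ∑-coloured-layers isEven true (λ _ → id) ⟨
      ∑[ y < N ] when (isEven ⌊ y /2⌋) (V y)           ≡⟨ balanced ⟩
      ∑[ y < N ] when (not (isEven ⌊ y /2⌋)) (V y)     ≡⟨ ∑-coloured-layers (not ∘ isEven) false (λ _ → not-injective) ⟩
      ∑[ j < m ] when (not (isEven j)) (V 2 + V 2)     ≡⟨ ∑<-when-isOdd h (V 2 + V 2) ⟩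
      h * (V 2 + V 2)                                  ∎)))
      where open ≡-Reasoning

  numColors≥3 : (L : Labeling G) → IsLocalAntimagic L → 3 ≤ numColors L
  numColors≥3 L antimagic = ≮⇒≥ λ fewer →
    let a , b , ⊆ab = ⊆-pair (deduplicate _≟_ (map (vsum L) (allFin N))) (ℕ.s≤s⁻¹ fewer)
        two-valued : ∀ y → y < N → V y ≡ a ⊎ V y ≡ b
        two-valued y y<N = subst (λ z → z ≡ a ⊎ z ≡ b) (sym (extend-fromℕ< (vsum L) y<N))
          (⊆ab _ (∈-deduplicate⁺ _≟_ (∈-map⁺ (vsum L) (∈-allFin (fromℕ< y<N)))))
    in TwoColouring.unbalanced V two-valued proper (trans (side-sum layerEven edge-parity)
                                                    (sym (side-sum layerOdd (cong not ∘ edge-parity))))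
    where
    V : ℕ → ℕ
    V = extend (vsum L)

    proper : ∀ {y y′} → y < N → y′ < N → blowupAdj y y′ ≡ true → V y ≢ V y′
    proper y<N y′<N yy′ Vy≡Vy′ = antimagic (fromℕ< y<N) (fromℕ< y′<N) (blowupAdj⇒adj y<N y′<N yy′)
      (trans (sym (extend-fromℕ< (vsum L) y<N)) (trans Vy≡Vy′ (extend-fromℕ< (vsum L) y′<N)))

    layerEven layerOdd : ℕ → Bool
    layerEven y = isEven ⌊ y /2⌋
    layerOdd  y = not (isEven ⌊ y /2⌋)

    edge-parity : ∀ e → layerEven (toℕ (proj₂ (edge G e))) ≡ not (layerEven (toℕ (proj₁ (edge G e))))
    edge-parity e = adj⇒parity (proj₁ (edge G e)) (proj₂ (edge G e)) (proj₂ (edge-ordered-adjacent G e))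

    side-sum : (P : ℕ → Bool) → (∀ e → P (toℕ (proj₂ (edge G e))) ≡ not (P (toℕ (proj₁ (edge G e))))) →
      ∑[ y < N ] when (P y) (V y) ≡ sum (map (label L) (allFin (nE G)))
    side-sum P separates = trans (sym (sum-allFin-extend N (λ y → when (P y)) (vsum L))) (∑-side≡∑-labels G L P separates)

  -- Upper bound

  q : ℕ
  q = m * 4

  -- the label of the edge joining copy s of layer p to copy t of layer next m p
  edgeLabel : ℕ → ℕ → ℕ → ℕ
  edgeLabel p s t = if isEven p then suc (p * 4 + (s * 2 + t)) else q ∸ (next m p * 4 + (t * 2 + s))

  edgeLabel-even : ∀ p s t → isEven p ≡ true → edgeLabel p s t ≡ suc (p * 4 + (s * 2 + t))
  edgeLabel-even p s t even rewrite even = refl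

  edgeLabel-odd : ∀ p s t → isEven p ≡ false → edgeLabel p s t ≡ q ∸ (next m p * 4 + (t * 2 + s))
  edgeLabel-odd p s t odd rewrite odd = refl

  edgeLabel-bounds : ∀ p s t → p < m → s ≤ 1 → t ≤ 1 → 1 ≤ edgeLabel p s t × edgeLabel p s t ≤ q
  edgeLabel-bounds p s t p<m s≤1 t≤1 with isEven p
  ... | true  = s≤s z≤n , i*d+s<m*d p (s * 2 + t) p<m (i*d+s<m*d {2} s t (s≤s s≤1) (s≤s t≤1))
  ... | false = m<n⇒0<n∸m (i*d+s<m*d (next m p) (t * 2 + s) (next<m p p<m) (i*d+s<m*d {2} t s (s≤s t≤1) (s≤s s≤1))) ,
                m∸n≤m q (next m p * 4 + (t * 2 + s))

  orientedLabel : ℕ → ℕ → ℕ → ℕ → ℕ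
  orientedLabel i j s t = if j ≡ᵇ next m i then edgeLabel i s t else edgeLabel j t s

  orientedLabel-next : ∀ i s t → orientedLabel i (next m i) s t ≡ edgeLabel i s t
  orientedLabel-next i s t rewrite ≡ᵇ-refl (next m i) = refl

  orientedLabel-prev : ∀ i s t → orientedLabel i (prev m i) s t ≡ edgeLabel (prev m i) t s
  orientedLabel-prev i s t rewrite ≢⇒≡ᵇ-false (prev m i) (next m i) (≢-sym (next≢prev i)) = refl

  orientedLabel-sym : ∀ i j s t → i < m → j < m → cycleAdj m i j ≡ true → orientedLabel i j s t ≡ orientedLabel j i t s
  orientedLabel-sym i j s t i<m j<m ij with cycleAdj⇒next⊎prev i j j<m ij
  ... | inj₁ refl rewrite orientedLabel-next i s t =
    sym (subst (λ z → orientedLabel (next m i) z t s ≡ edgeLabel z s t) (prev-next i) (orientedLabel-prev (next m i) t s))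
  ... | inj₂ refl rewrite orientedLabel-prev i s t =
    sym (subst (λ z → orientedLabel (prev m i) z t s ≡ edgeLabel (prev m i) t s) (next-prev i i<m) (orientedLabel-next (prev m i) t s))

  weight : ℕ → ℕ → ℕ
  weight x y = orientedLabel ⌊ x /2⌋ ⌊ y /2⌋ (copy x) (copy y)

  weight-layer-copy : ∀ i j s t → s ≤ 1 → t ≤ 1 → weight (i * 2 + s) (j * 2 + t) ≡ orientedLabel i j s t
  weight-layer-copy i j s t s≤1 t≤1
    rewrite proj₁ (layer-copy i s s≤1) | proj₂ (layer-copy i s s≤1)
          | proj₁ (layer-copy j t t≤1) | proj₂ (layer-copy j t t≤1) = refl

  weight-sym : ∀ x y → x < N → y < N → blowupAdj x y ≡ true → weight x y ≡ weight y x
  weight-sym x y x<N y<N = orientedLabel-sym _ _ (copy x) (copy y) (⌊n/2⌋<m m x x<N) (⌊n/2⌋<m m y y<N)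

  weight-bounds : ∀ x y → x < N → y < N → 1 ≤ weight x y × weight x y ≤ q
  weight-bounds x y x<N y<N with ⌊ y /2⌋ ≡ᵇ next m ⌊ x /2⌋
  ... | true  = edgeLabel-bounds ⌊ x /2⌋ (copy x) (copy y) (⌊n/2⌋<m m x x<N) (copy≤1 x) (copy≤1 y)
  ... | false = edgeLabel-bounds ⌊ y /2⌋ (copy y) (copy x) (⌊n/2⌋<m m y y<N) (copy≤1 y) (copy≤1 x)

  ∑-incident : (W : ℕ → ℕ → ℕ) → (∀ x y → x < N → y < N → blowupAdj x y ≡ true → W x y ≡ W y x) → (x : Fin N) →
    sum (map (λ e → when (incident G x e) (onEdge G W e)) (allFin (nE G)))
    ≡ (W (toℕ x) (next m ⌊ toℕ x /2⌋ * 2) + W (toℕ x) (suc (next m ⌊ toℕ x /2⌋ * 2)))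
      + (W (toℕ x) (prev m ⌊ toℕ x /2⌋ * 2) + W (toℕ x) (suc (prev m ⌊ toℕ x /2⌋ * 2)))
  ∑-incident W W-sym x = trans (∑-incident≡∑-adjacent W W-sym x) (∑-blowupAdj (toℕ x) (layer<m x) (W (toℕ x)))

  nE≡q : nE G ≡ q
  nE≡q = *-cancelʳ-≡ (nE G) q 2 (begin
    nE G * 2
      ≡⟨ trans (sum-allFin (nE G) (λ _ → 2)) (∑<-const (nE G) 2) ⟨
    sum (map (λ e → onEdge G (λ a b → when true 1 + when true 1) e) (allFin (nE G)))
      ≡⟨ double-counting G (λ _ → 1) (λ _ → true) ⟨
    sum (map (λ x → sum (map (λ e → when (incident G x e) 1) (allFin (nE G)))) (allFin N))
      ≡⟨ cong sum (LP.map-cong (∑-incident (λ _ _ → 1) (λ _ _ _ _ _ → refl)) (allFin N)) ⟩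
    sum (map (λ _ → 4) (allFin N))
      ≡⟨ trans (sum-allFin N (λ _ → 4)) (∑<-const N 4) ⟩
    N * 4
      ≡⟨ trans (*-assoc m 2 4) (sym (*-assoc m 4 2)) ⟩
    q * 2 ∎)
    where open ≡-Reasoning

  edgeWeight : Fin (nE G) → ℕ
  edgeWeight = onEdge G weight

  edgeWeight-bounds : ∀ e → 1 ≤ edgeWeight e × edgeWeight e ≤ q
  edgeWeight-bounds e = weight-bounds (toℕ (proj₁ (edge G e))) (toℕ (proj₂ (edge G e))) (FinP.toℕ<n (proj₁ (edge G e))) (FinP.toℕ<n (proj₂ (edge G e)))

  edgeWeight∸1<nE : ∀ e → edgeWeight e ∸ 1 < nE G
  edgeWeight∸1<nE e = subst (edgeWeight e ∸ 1 <_) (sym nE≡q)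
    (subst (_≤ q) (sym (suc[n∸1]≡n (proj₁ (edgeWeight-bounds e)))) (proj₂ (edgeWeight-bounds e)))

  labelIndex : Fin (nE G) → Fin (nE G)
  labelIndex e = fromℕ< (edgeWeight∸1<nE e)

  toℕ-labelIndex : ∀ e → suc (toℕ (labelIndex e)) ≡ edgeWeight e
  toℕ-labelIndex e = trans (cong suc (FinP.toℕ-fromℕ< (edgeWeight∸1<nE e))) (suc[n∸1]≡n (proj₁ (edgeWeight-bounds e)))

  edgeWeight-realises< : ∀ {x y} (x<N : x < N) (y<N : y < N) → x < y → blowupAdj x y ≡ true →
    ∃ λ e → edgeWeight e ≡ weight x y
  edgeWeight-realises< x<N y<N x<y xy =
    let e , e≡xy = edge-of-adjacent G {fromℕ< x<N} {fromℕ< y<N}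
                     (subst₂ _<_ (sym (FinP.toℕ-fromℕ< x<N)) (sym (FinP.toℕ-fromℕ< y<N)) x<y)
                     (blowupAdj⇒adj x<N y<N xy)
    in e , trans (cong (λ uv → weight (toℕ (proj₁ uv)) (toℕ (proj₂ uv))) e≡xy)
                 (cong₂ weight (FinP.toℕ-fromℕ< x<N) (FinP.toℕ-fromℕ< y<N))

  edgeWeight-realises : ∀ x y → x < N → y < N → blowupAdj x y ≡ true → ∃ λ e → edgeWeight e ≡ weight x y
  edgeWeight-realises x y x<N y<N xy = by-order (<-cmp x y)
    where
    by-order : Tri (x < y) (x ≡ y) (y < x) → ∃ λ e → edgeWeight e ≡ weight x y
    by-order (tri< x<y _ _) = edgeWeight-realises< x<N y<N x<y xy
    by-order (tri≈ _ x≡y _) = contradiction (trans (sym xy) (subst (λ z → blowupAdj x z ≡ false) x≡y (blowupAdj-irrefl x))) λ ()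
    by-order (tri> _ _ y<x) =
      let yx = trans (blowupAdj-sym y x) xy
          e , w≡ = edgeWeight-realises< y<N x<N y<x yx
      in e , trans w≡ (weight-sym y x y<N x<N yx)

  Realised : ℕ → Set
  Realised t = ∃₂ λ x y → x < N × y < N × blowupAdj x y ≡ true × weight x y ≡ suc t

  realised-even : ∀ i s t → i < m → isEven i ≡ true → s ≤ 1 → t ≤ 1 → Realised ((s * 2 + t) + i * 4)
  realised-even i s t i<m even s≤1 t≤1 =
    i * 2 + s , suc i * 2 + t , i*d+s<m*d i s i<m (s≤s s≤1) , i*d+s<m*d (suc i) t i+1<m (s≤s t≤1) , adjacent , weighs
    where
    i+1≢m : suc i ≢ m
    i+1≢m i+1≡m = contradiction (trans (cong not (sym even)) (trans (cong isEven i+1≡m) isEven-m)) λ ()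
    i+1<m : suc i < m
    i+1<m = ≤∧≢⇒< i<m i+1≢m
    next≡i+1 : next m i ≡ suc i
    next≡i+1 rewrite ≢⇒≡ᵇ-false (suc i) m i+1≢m = refl
    adjacent : blowupAdj (i * 2 + s) (suc i * 2 + t) ≡ true
    adjacent = trans (cong₂ (cycleAdj m) (proj₁ (layer-copy i s s≤1)) (proj₁ (layer-copy (suc i) t t≤1))) (cycleAdj-suc m i)
    weighs : weight (i * 2 + s) (suc i * 2 + t) ≡ suc ((s * 2 + t) + i * 4)
    weighs = begin
      weight (i * 2 + s) (suc i * 2 + t) ≡⟨ weight-layer-copy i (suc i) s t s≤1 t≤1 ⟩
      orientedLabel i (suc i) s t        ≡⟨ cong (λ j → orientedLabel i j s t) next≡i+1 ⟨
      orientedLabel i (next m i) s t     ≡⟨ orientedLabel-next i s t ⟩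
      edgeLabel i s t                    ≡⟨ edgeLabel-even i s t even ⟩
      suc (i * 4 + (s * 2 + t))          ≡⟨ cong suc (+-comm (i * 4) (s * 2 + t)) ⟩
      suc ((s * 2 + t) + i * 4)          ∎
      where open ≡-Reasoning

  q-split : ∀ j i c r → j + suc i ≡ m → c + r ≡ 3 → (j * 4 + c) + suc (r + i * 4) ≡ q
  q-split j i c r j+1+i≡m c+r≡3 = begin
    j * 4 + c + suc (r + i * 4)   ≡⟨ +-assoc (j * 4) c _ ⟩
    j * 4 + (c + suc (r + i * 4)) ≡⟨ cong (j * 4 +_) (+-suc c _) ⟩
    j * 4 + suc (c + (r + i * 4)) ≡⟨ cong (λ z → j * 4 + suc z) (+-assoc c r _) ⟨
    j * 4 + suc (c + r + i * 4)   ≡⟨ cong (λ z → j * 4 + suc (z + i * 4)) c+r≡3 ⟩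
    j * 4 + suc i * 4             ≡⟨ *-distribʳ-+ 4 j (suc i) ⟨
    (j + suc i) * 4               ≡⟨ cong (_* 4) j+1+i≡m ⟩
    q                             ∎
    where open ≡-Reasoning

  realised-odd : ∀ g s t r → suc (g * 2) < m → s ≤ 1 → t ≤ 1 → (t * 2 + s) + r ≡ 3 → Realised (r + suc (g * 2) * 4)
  realised-odd g s t r i<m s≤1 t≤1 c+r≡3 =
    p * 2 + s , j * 2 + t , i*d+s<m*d p s p<m (s≤s s≤1) , i*d+s<m*d j t j<m (s≤s t≤1) , adjacent , weighs
    where
    -- the odd label block i is carried by the edges leaving p = prev m j, where j = m − 1 − i
    i c : ℕ
    i = suc (g * 2)
    c = t * 2 + s
    g<h : g < h
    g<h = *-cancelʳ-< 2 g h (<-trans (n<1+n (g * 2)) i<m)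
    j : ℕ
    j = (h ∸ suc g) * 2
    j+1+i≡m : j + suc i ≡ m
    j+1+i≡m = trans (sym (*-distribʳ-+ 2 (h ∸ suc g) (suc g))) (cong (_* 2) (m∸n+n≡m g<h))
    j<m : j < m
    j<m = subst (j <_) j+1+i≡m (m<m+n j z<s)
    p : ℕ
    p = prev m j
    p<m : p < m
    p<m = prev<m j j<m
    next-p : next m p ≡ j
    next-p = next-prev j j<m
    p-odd : isEven p ≡ false
    p-odd = trans (isEven-prev j j<m) (cong not (isEven-*2 (h ∸ suc g)))
    adjacent : blowupAdj (p * 2 + s) (j * 2 + t) ≡ true
    adjacent = trans (cong₂ (cycleAdj m) (proj₁ (layer-copy p s s≤1)) (trans (proj₁ (layer-copy j t t≤1)) (sym next-p)))
                     (cycleAdj-next p p<m)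
    weighs : weight (p * 2 + s) (j * 2 + t) ≡ suc (r + i * 4)
    weighs = begin
      weight (p * 2 + s) (j * 2 + t)      ≡⟨ weight-layer-copy p j s t s≤1 t≤1 ⟩
      orientedLabel p j s t               ≡⟨ cong (λ z → orientedLabel p z s t) next-p ⟨
      orientedLabel p (next m p) s t      ≡⟨ orientedLabel-next p s t ⟩
      edgeLabel p s t                     ≡⟨ edgeLabel-odd p s t p-odd ⟩
      q ∸ (next m p * 4 + c)              ≡⟨ cong (λ z → q ∸ (z * 4 + c)) next-p ⟩
      q ∸ (j * 4 + c)                     ≡⟨ cong (_∸ (j * 4 + c)) (q-split j i c r j+1+i≡m c+r≡3) ⟨
      j * 4 + c + suc (r + i * 4) ∸ (j * 4 + c) ≡⟨ m+n∸m≡n (j * 4 + c) _ ⟩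
      suc (r + i * 4)                     ∎
      where open ≡-Reasoning

  realised-digits : ∀ i r → i < m → r < 4 → Realised (r + i * 4)
  realised-digits i r i<m r<4 with even⊎odd i
  ... | g , inj₁ refl = subst (λ z → Realised (z + g * 2 * 4)) (⌊n/2⌋*2+copy≡n r)
    (realised-even (g * 2) ⌊ r /2⌋ (copy r) i<m (isEven-*2 g) (ℕ.s≤s⁻¹ (⌊n/2⌋<m 2 r r<4)) (copy≤1 r))
  ... | g , inj₂ refl = realised-odd g (copy c) ⌊ c /2⌋ r i<m (copy≤1 c) (ℕ.s≤s⁻¹ (⌊n/2⌋<m 2 c (s≤s (m∸n≤m 3 r))))
    (trans (cong (_+ r) (⌊n/2⌋*2+copy≡n c)) (m∸n+n≡m (ℕ.s≤s⁻¹ r<4)))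
    where
    c : ℕ
    c = 3 ∸ r

  realised : ∀ t → t < q → Realised t
  realised t t<q = subst Realised (sym (m≡m%n+[m/n]*n t 4)) (realised-digits (t / 4) (t % 4) (m<n*o⇒m/o<n t<q) (m%n<n t 4))

  labelIndex-surjective : ∀ t → ∃ λ e → labelIndex e ≡ t
  labelIndex-surjective t =
    let x , y , x<N , y<N , xy , w≡t+1 = realised (toℕ t) (subst (toℕ t <_) nE≡q (FinP.toℕ<n t))
        e , w≡ = edgeWeight-realises x y x<N y<N xy
    in e , FinP.toℕ-injective (trans (FinP.toℕ-fromℕ< (edgeWeight∸1<nE e)) (cong (_∸ 1) (trans w≡ w≡t+1)))

  labeling : Labeling G
  labeling = record
    { f   = labelIndex
    ; bij = surjective⇒injective labelIndex labelIndex-surjective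
          , λ t → proj₁ (labelIndex-surjective t) , λ { refl → proj₂ (labelIndex-surjective t) } }

  σ-even σ-odd σ-last : ℕ
  σ-even = suc q + suc q
  σ-odd  = (q ∸ 7) + (q ∸ 7)
  σ-last = (q + suc ((m ∸ 2) * 4)) + (q + suc ((m ∸ 2) * 4))

  σ-odd<σ-even : σ-odd < σ-even
  σ-odd<σ-even = +-mono-< (s≤s (m∸n≤m q 7)) (s≤s (m∸n≤m q 7))

  σ-even<σ-last : σ-even < σ-last
  σ-even<σ-last = +-mono-< q+1<last q+1<last
    where
    q+1<last : suc q < q + suc ((m ∸ 2) * 4)
    q+1<last = subst (_< q + suc ((m ∸ 2) * 4)) (+-comm q 1) (+-monoʳ-< q (s≤s (s≤s z≤n)))

  layerSum : ℕ → ℕ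
  layerSum i = if isEven i then σ-even else if suc i ≡ᵇ m then σ-last else σ-odd

  incidentLabels : ℕ → ℕ → ℕ
  incidentLabels i a = (edgeLabel i a 0 + edgeLabel i a 1) + (edgeLabel (prev m i) 0 a + edgeLabel (prev m i) 1 a)

  incidentLabels-even : ∀ i a → i < m → a ≤ 1 → isEven i ≡ true → incidentLabels i a ≡ σ-even
  incidentLabels-even i a i<m a≤1 even = begin
    incidentLabels i a
      ≡⟨ cong₂ _+_ (cong₂ _+_ (edgeLabel-even i a 0 even) (edgeLabel-even i a 1 even))
                   (cong₂ _+_ (edgeLabel-odd (prev m i) 0 a prev-odd) (edgeLabel-odd (prev m i) 1 a prev-odd)) ⟩
    (suc z₀ + suc z₁) + ((q ∸ (next m (prev m i) * 4 + (a * 2 + 0))) + (q ∸ (next m (prev m i) * 4 + (a * 2 + 1))))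
      ≡⟨ cong (λ j → (suc z₀ + suc z₁) + ((q ∸ (j * 4 + (a * 2 + 0))) + (q ∸ (j * 4 + (a * 2 + 1))))) (next-prev i i<m) ⟩
    (suc z₀ + suc z₁) + ((q ∸ z₀) + (q ∸ z₁))
      ≡⟨ interchange (suc z₀) (suc z₁) (q ∸ z₀) (q ∸ z₁) ⟩
    (suc z₀ + (q ∸ z₀)) + (suc z₁ + (q ∸ z₁))
      ≡⟨ cong₂ _+_ (cong suc (m+[n∸m]≡n (<⇒≤ (z<q 0 z≤n)))) (cong suc (m+[n∸m]≡n (<⇒≤ (z<q 1 ≤-refl)))) ⟩
    σ-even ∎
    where
    open ≡-Reasoning
    prev-odd : isEven (prev m i) ≡ false
    prev-odd = trans (isEven-prev i i<m) (cong not even)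
    z₀ z₁ : ℕ
    z₀ = i * 4 + (a * 2 + 0)
    z₁ = i * 4 + (a * 2 + 1)
    z<q : ∀ b → b ≤ 1 → i * 4 + (a * 2 + b) < q
    z<q b b≤1 = i*d+s<m*d i _ i<m (i*d+s<m*d {2} a b (s≤s a≤1) (s≤s b≤1))

  incidentLabels-odd : ∀ i a → a ≤ 1 → isEven (suc i) ≡ false → (ν : ℕ) → next m (suc i) ≡ ν →
    incidentLabels (suc i) a ≡ ((q ∸ (ν * 4 + (0 * 2 + a))) + suc (i * 4 + (0 * 2 + a)))
                               + ((q ∸ (ν * 4 + (1 * 2 + a))) + suc (i * 4 + (1 * 2 + a)))
  incidentLabels-odd i a a≤1 odd ν refl = begin
    incidentLabels (suc i) a
      ≡⟨ cong₂ _+_ (cong₂ _+_ (edgeLabel-odd (suc i) a 0 odd) (edgeLabel-odd (suc i) a 1 odd))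
                   (cong₂ _+_ (edgeLabel-even i 0 a i-even) (edgeLabel-even i 1 a i-even)) ⟩
    ((q ∸ (ν * 4 + (0 * 2 + a))) + (q ∸ (ν * 4 + (1 * 2 + a)))) + (suc (i * 4 + (0 * 2 + a)) + suc (i * 4 + (1 * 2 + a)))
      ≡⟨ interchange (q ∸ (ν * 4 + (0 * 2 + a))) (q ∸ (ν * 4 + (1 * 2 + a))) (suc (i * 4 + (0 * 2 + a))) (suc (i * 4 + (1 * 2 + a))) ⟩
    ((q ∸ (ν * 4 + (0 * 2 + a))) + suc (i * 4 + (0 * 2 + a))) + ((q ∸ (ν * 4 + (1 * 2 + a))) + suc (i * 4 + (1 * 2 + a))) ∎
    where
    open ≡-Reasoning
    i-even : isEven i ≡ true
    i-even = not-injective odd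

  incidentLabels-inner : ∀ i a → suc (suc i) < m → a ≤ 1 → isEven (suc i) ≡ false → incidentLabels (suc i) a ≡ σ-odd
  incidentLabels-inner i a i+2<m a≤1 odd = trans (incidentLabels-odd i a a≤1 odd (suc (suc i)) next≡i+2) (cong₂ _+_ (pair 0 z≤n) (pair 1 ≤-refl))
    where
    next≡i+2 : next m (suc i) ≡ suc (suc i)
    next≡i+2 rewrite ≢⇒≡ᵇ-false (suc (suc i)) m (<⇒≢ i+2<m) = refl
    pair : ∀ b → b ≤ 1 → (q ∸ (suc (suc i) * 4 + (b * 2 + a))) + suc (i * 4 + (b * 2 + a)) ≡ q ∸ 7
    pair b b≤1 = [n∸[8+y]]+[1+y]≡n∸7 q (i * 4 + (b * 2 + a))
      (<⇒≤ (i*d+s<m*d (suc (suc i)) (b * 2 + a) i+2<m (i*d+s<m*d {2} b a (s≤s b≤1) (s≤s a≤1))))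

  incidentLabels-last : ∀ a → a ≤ 1 → incidentLabels (m ∸ 1) a ≡ σ-last
  incidentLabels-last a a≤1 = trans (incidentLabels-odd (m ∸ 2) a a≤1 (cong not (isEven-*2 (suc k))) 0 next≡0) (cong₂ _+_ (pair 0 z≤n) (pair 1 ≤-refl))
    where
    next≡0 : next m (m ∸ 1) ≡ 0
    next≡0 rewrite ≡ᵇ-refl (k * 2) = refl
    pair : ∀ b → b ≤ 1 → (q ∸ (b * 2 + a)) + suc ((m ∸ 2) * 4 + (b * 2 + a)) ≡ q + suc ((m ∸ 2) * 4)
    pair b b≤1 = [n∸c]+[1+w+c]≡n+[1+w] q (b * 2 + a) ((m ∸ 2) * 4)
      (<⇒≤ (i*d+s<m*d {m} {4} 0 (b * 2 + a) z<s (i*d+s<m*d {2} b a (s≤s b≤1) (s≤s a≤1))))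

  layerSum-even : ∀ i → isEven i ≡ true → layerSum i ≡ σ-even
  layerSum-even i even rewrite even = refl

  layerSum-odd : ∀ i → isEven i ≡ false → layerSum i ≡ (if suc i ≡ᵇ m then σ-last else σ-odd)
  layerSum-odd i odd rewrite odd = refl

  incidentLabels≡layerSum : ∀ i a → i < m → a ≤ 1 → incidentLabels i a ≡ layerSum i
  incidentLabels≡layerSum zero    a 0<m a≤1 = incidentLabels-even 0 a 0<m a≤1 refl
  incidentLabels≡layerSum (suc i) a i<m a≤1 = by-parity (isEven (suc i)) refl
    where
    by-position : ∀ c → (suc (suc i) ≡ᵇ m) ≡ c → isEven (suc i) ≡ false →
      incidentLabels (suc i) a ≡ (if c then σ-last else σ-odd)
    by-position true  last _   = subst (λ j → incidentLabels (suc j) a ≡ σ-last)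
      (sym (suc-injective (suc-injective (≡ᵇ-true⇒≡ (suc (suc i)) m last)))) (incidentLabels-last a a≤1)
    by-position false last odd = incidentLabels-inner i a (≤∧≢⇒< i<m (≡ᵇ-false⇒≢ (suc (suc i)) m last)) a≤1 odd
    by-parity : ∀ b → isEven (suc i) ≡ b → incidentLabels (suc i) a ≡ layerSum (suc i)
    by-parity true  even = trans (incidentLabels-even (suc i) a i<m a≤1 even) (sym (layerSum-even (suc i) even))
    by-parity false odd  = trans (by-position (suc (suc i) ≡ᵇ m) refl odd) (sym (layerSum-odd (suc i) odd))

  vsum-labeling : ∀ x → vsum labeling x ≡ layerSum ⌊ toℕ x /2⌋
  vsum-labeling x = begin
    vsum labeling x
      ≡⟨ cong sum (LP.map-cong (λ e → cong (when (incident G x e)) (toℕ-labelIndex e)) (allFin (nE G))) ⟩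
    sum (map (λ e → when (incident G x e) (edgeWeight e)) (allFin (nE G)))
      ≡⟨ ∑-incident weight weight-sym x ⟩
    (weight n (ν * 2) + weight n (suc (ν * 2))) + (weight n (π * 2) + weight n (suc (π * 2)))
      ≡⟨ cong₂ _+_ (cong₂ _+_ (to-next (copy-*2 ν) (⌊n*2/2⌋≡n ν)) (to-next (copy-1+*2 ν) (⌊1+n*2/2⌋≡n ν)))
                   (cong₂ _+_ (to-prev (copy-*2 π) (⌊n*2/2⌋≡n π)) (to-prev (copy-1+*2 π) (⌊1+n*2/2⌋≡n π))) ⟩
    incidentLabels i (copy n)
      ≡⟨ incidentLabels≡layerSum i (copy n) (layer<m x) (copy≤1 n) ⟩
    layerSum i ∎
    where
    open ≡-Reasoning
    n i ν π : ℕ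
    n = toℕ x
    i = ⌊ n /2⌋
    ν = next m i
    π = prev m i
    to-next : ∀ {y s} → copy y ≡ s → ⌊ y /2⌋ ≡ ν → weight n y ≡ edgeLabel i (copy n) s
    to-next refl y∈ν = trans (cong (λ j → orientedLabel i j (copy n) _) y∈ν) (orientedLabel-next i (copy n) _)
    to-prev : ∀ {y s} → copy y ≡ s → ⌊ y /2⌋ ≡ π → weight n y ≡ edgeLabel π s (copy n)
    to-prev refl y∈π = trans (cong (λ j → orientedLabel i j (copy n) _) y∈π) (orientedLabel-prev i (copy n) _)

  layerSum≡σ-even⇒isEven : ∀ i → layerSum i ≡ σ-even → isEven i ≡ true
  layerSum≡σ-even⇒isEven i = by-cases (isEven i) (suc i ≡ᵇ m)
    where
    by-cases : ∀ b c → (if b then σ-even else if c then σ-last else σ-odd) ≡ σ-even → b ≡ true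
    by-cases true  _     _ = refl
    by-cases false true  e = contradiction e (≢-sym (<⇒≢ σ-even<σ-last))
    by-cases false false e = contradiction e (<⇒≢ σ-odd<σ-even)

  layerSum-separates : ∀ i j → isEven j ≡ not (isEven i) → layerSum i ≢ layerSum j
  layerSum-separates i j j-parity eq = by-parity (isEven i) refl
    where
    by-parity : ∀ b → isEven i ≡ b → ⊥
    by-parity true  even = contradiction (trans (sym (layerSum≡σ-even⇒isEven j (trans (sym eq) (layerSum-even i even)))) (trans j-parity (cong not even))) λ ()
    by-parity false odd  = contradiction (trans (sym (layerSum≡σ-even⇒isEven i (trans eq (layerSum-even j (trans j-parity (cong not odd)))))) odd) λ ()

  labeling-antimagic : IsLocalAntimagic labeling
  labeling-antimagic u v uv sums≡ = layerSum-separates ⌊ toℕ u /2⌋ ⌊ toℕ v /2⌋ (adj⇒parity u v uv)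
    (trans (sym (vsum-labeling u)) (trans sums≡ (vsum-labeling v)))

  layerSum∈ : ∀ i → layerSum i ∈ σ-even ∷ σ-odd ∷ σ-last ∷ []
  layerSum∈ i = by-cases (isEven i) (suc i ≡ᵇ m)
    where
    by-cases : ∀ b c → (if b then σ-even else if c then σ-last else σ-odd) ∈ σ-even ∷ σ-odd ∷ σ-last ∷ []
    by-cases true  _     = here refl
    by-cases false true  = there (there (here refl))
    by-cases false false = there (here refl)

  colours : List ℕ
  colours = deduplicate _≟_ (map (vsum labeling) (allFin N))

  colours⊆σ : ∀ {z} → z ∈ colours → z ∈ σ-even ∷ σ-odd ∷ σ-last ∷ []
  colours⊆σ {z} z∈ =
    let x , _ , z≡ = ∈-map⁻ (vsum labeling) {z} {allFin N} (∈-deduplicate⁻ _≟_ (map (vsum labeling) (allFin N)) z∈)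
    in subst (_∈ σ-even ∷ σ-odd ∷ σ-last ∷ []) (sym (trans z≡ (vsum-labeling x))) (layerSum∈ ⌊ toℕ x /2⌋)

  layerSum∈colours : ∀ {y} (y<N : y < N) → layerSum ⌊ y /2⌋ ∈ colours
  layerSum∈colours {y} y<N = subst (_∈ colours)
    (trans (vsum-labeling (fromℕ< y<N)) (cong (λ z → layerSum ⌊ z /2⌋) (FinP.toℕ-fromℕ< y<N)))
    (∈-deduplicate⁺ _≟_ (∈-map⁺ (vsum labeling) (∈-allFin (fromℕ< y<N))))

  σ⊆colours : ∀ {z} → z ∈ σ-even ∷ σ-odd ∷ σ-last ∷ [] → z ∈ colours
  σ⊆colours (here refl)                 = layerSum∈colours {0} z<s
  σ⊆colours (there (here refl))         = layerSum∈colours {2} (s≤s (s≤s (s≤s z≤n)))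
  σ⊆colours (there (there (here refl))) = subst (_∈ colours) layerSum-last (layerSum∈colours {(m ∸ 1) * 2} (*-monoˡ-< 2 (n<1+n (m ∸ 1))))
    where
    layerSum-last : layerSum ⌊ (m ∸ 1) * 2 /2⌋ ≡ σ-last
    layerSum-last = begin
      layerSum ⌊ (m ∸ 1) * 2 /2⌋               ≡⟨ cong layerSum (⌊n*2/2⌋≡n (m ∸ 1)) ⟩
      layerSum (m ∸ 1)                         ≡⟨ layerSum-odd (m ∸ 1) (cong not (isEven-*2 (suc k))) ⟩
      (if k * 2 ≡ᵇ k * 2 then σ-last else σ-odd) ≡⟨ cong (λ b → if b then σ-last else σ-odd) (≡ᵇ-refl (k * 2)) ⟩
      σ-last                                   ∎
      where open ≡-Reasoning

  σ-distinct : Unique (σ-even ∷ σ-odd ∷ σ-last ∷ [])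
  σ-distinct = (≢-sym (<⇒≢ σ-odd<σ-even) All.∷ <⇒≢ σ-even<σ-last All.∷ All.[])
             ∷ (<⇒≢ (<-trans σ-odd<σ-even σ-even<σ-last) All.∷ All.[])
             ∷ All.[] ∷ []

  numColors≡3 : numColors labeling ≡ 3
  numColors≡3 = ≤-antisym (Unique⇒length≤ (deduplicate-! _≟_ (map (vsum labeling) (allFin N))) colours⊆σ)
                          (Unique⇒length≤ σ-distinct σ⊆colours)

  χla≡3 : ChiLa≡ G 3
  χla≡3 = (labeling , labeling-antimagic , numColors≡3) , numColors≥3

corollary2p10 : ∀ (n : ℕ) → 2 ≤ n → ChiLa≡ (Lex (Cycle (2 * n)) (Empty 2)) 3
corollary2p10 (suc (suc k)) (s≤s (s≤s z≤n)) = subst (λ c → ChiLa≡ (Blowup c) 3) (*-comm (suc (suc k)) 2) (EvenCycle.χla≡3 k)
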